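{- For all integers $n,k$ with $1\le k\le n$, there exists an instance on a tree with $n$ nodes and $k$ agents/pebbles for which: the plan produced by $\mathit{process\_subtree}(r)$ has makespan exactly $n-k$ and sum of costs exactly $k(n-k)$, and the minimum pebble-motion plan length satisfies $\mathit{OPT}=k(n-k)$. That is, the bounds $M\le n-k$, $S\le k(n-k)$ and $\mathit{OPT}\le k(n-k)$ are tight.
   Context: Unlabeled Pebble Motion on Trees: tree with $n$ nodes, $k$ pebbles on distinct nodes, $k$ distinct targets; a move moves a pebble to an adjacent pebble-free node; $\mathit{OPT}$ = minimum number of moves after which all pebbles are on targets. Unlabeled MAPF on the same data: discrete time, each timestep each agent waits or moves to an adjacent node; feasible plans avoid two agents on one node at one time and opposite traversals of an edge in one timestep, and end with all agents on targets. Path length of an agent = number of timesteps (moves and waits) until it reaches its final target for the last time; makespan $M$ = max, sum of costs $S$ = sum. Fix root $r$; $T_u$ subtree at $u$; $agent(u),target(u)\in\{0,1\}$; demand $d(u)=\sum_{v\in T_u}target(v)-\sum_{v\in T_u}agent(v)$. Each node has a list $l(u)$ (initially empty; $\max$ of empty list $=0$) and integer $s(u)$ (initially $0$). $\mathit{send\_agent}(u,t)$: if $d(u)<0$: append $t+1$ to $l(parent(u))$, output move $(u,parent(u),t)$, $d(u)\gets d(u)+1$; else if some child $v$ has $d(v)>0$: pick one, append $t+1$ to $l(v)$, output move $(u,v,t)$, $d(v)\gets d(v)-1$; else nothing. $\mathit{process\_subtree}(u)$: if $agent(u)=1$ insert $s(u)$ at the start of $l(u)$; for each child $v$ with $d(v)<0$: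 $s(v)\gets\max(s(u)-1,\max l(u),0)$, call $\mathit{process\_subtree}(v)$; for each $t\in l(u)$ in order call $\mathit{send\_agent}(u,t)$; mark $u$ processed; call $\mathit{process\_subtree}(v)$ for each unprocessed child $v$. Move $(u,v,t)$: an agent leaves $u$ at time $t$, arriving at $v$ at $t+1$; agents wait at their start before their first move and stay after their last move. -}

module Defs where

open import Data.Nat using (ℕ; zero; suc; _+_; _*_; _∸_; _≤_; _<_; _⊔_; _≡ᵇ_; _<ᵇ_)
open import Data.Integer using (ℤ; +_; -[1+_]) renaming (_+_ to _+ℤ_; _-_ to _-ℤ_)
open import Data.Fin using (Fin; toℕ; _≟_)
open import Data.Bool using (Bool; true; false; if_then_else_; _∧_; not)
open import Data.List using (List; []; _∷_; _++_; [_]; map; foldl; foldr; upTo; allFin)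
open import Data.Nat.ListAction using (sum)
open import Data.Maybe using (Maybe; just; nothing)
open import Data.Product using (Σ; _×_; _,_; proj₁; proj₂)
open import Data.Sum using (_⊎_)
open import Relation.Nullary using (does)
open import Relation.Binary.PropositionalEquality using (_≡_)

-- Every tree with n nodes, rooted anywhere, is isomorphic to one whose
-- nodes are numbered (e.g. in BFS order) so that the root is node 0 and
-- each non-root node has a parent of strictly smaller index.  The
-- undirected tree consists of the edges {i , parent i} for i ≠ root.

record Tree (n : ℕ) : Set where
  field
    root      : Fin n
    root-zero : toℕ root ≡ 0
    parent    : Fin n → Fin n
    parent-lt : ∀ i → 0 < toℕ i → toℕ (parent i) < toℕ i
open Tree public

isRoot : ∀ {n} → Fin n → Bool
isRoot i = toℕ i ≡ᵇ 0

Adjacent : ∀ {n} → Tree n → Fin n → Fin n → Set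
Adjacent T u v = (0 < toℕ u × parent T u ≡ v) ⊎ (0 < toℕ v × parent T v ≡ u)

filterB : ∀ {A : Set} → (A → Bool) → List A → List A
filterB p [] = []
filterB p (x ∷ xs) = if p x then x ∷ filterB p xs else filterB p xs

anyB : ∀ {A : Set} → (A → Bool) → List A → Bool
anyB p [] = false
anyB p (x ∷ xs) = if p x then true else anyB p xs

_==_ : ∀ {n} → Fin n → Fin n → Bool
i == j = does (i ≟ j)

children : ∀ {n} → Tree n → Fin n → List (Fin n)
children {n} T u = filterB (λ v → not (isRoot v) ∧ (parent T v == u)) (allFin n)

-- v together with its ancestors (fuel n suffices, as depth < n)
ancestorsF : ∀ {n} → Tree n → ℕ → Fin n → List (Fin n)
ancestorsF T zero v = v ∷ []
ancestorsF T (suc f) v = v ∷ (if isRoot v then [] else ancestorsF T f (parent T v))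

inSubtree : ∀ {n} → Tree n → Fin n → Fin n → Bool
inSubtree {n} T u v = anyB (λ w → w == u) (ancestorsF T n v)

count : ∀ {n} → (Fin n → Bool) → ℕ
count {n} c = sum (map (λ i → if c i then 1 else 0) (allFin n))

record Instance (n k : ℕ) : Set where
  field
    tree        : Tree n
    agent       : Fin n → Bool
    target      : Fin n → Bool
    agent-count : count agent ≡ k
    target-count : count target ≡ k
open Instance public

b2ℤ : Bool → ℤ
b2ℤ true = + 1
b2ℤ false = + 0

demand : ∀ {n k} → Instance n k → Fin n → ℤ
demand {n} I u =
  foldr (λ v acc → if inSubtree (tree I) u v
                     then (b2ℤ (target I v) -ℤ b2ℤ (agent I v)) +ℤ acc
                     else acc)
        (+ 0) (allFin n)

-- a move (u , v , t): an agent leaves u at time t and arrives at v at t+1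
Move : ℕ → Set
Move n = Fin n × Fin n × ℕ

record State (n : ℕ) : Set where
  field
    dS   : Fin n → ℤ
    lS   : Fin n → List ℕ
    sS   : Fin n → ℕ
    proc : Fin n → Bool
    out  : List (Move n)
open State public

upd : ∀ {n} {A : Set} → (Fin n → A) → Fin n → A → Fin n → A
upd f i a j = if j == i then a else f j

isNeg : ℤ → Bool
isNeg -[1+ _ ] = true
isNeg (+ _)    = false

isPos : ℤ → Bool
isPos (+ suc _) = true
isPos _         = false

maxList : List ℕ → ℕ
maxList = foldr _⊔_ 0

firstB : ∀ {A : Set} → (A → Bool) → List A → Maybe A
firstB p [] = nothing
firstB p (x ∷ xs) = if p x then just x else firstB p xs

-- send_agent(u,t); "pick one" child is resolved as the first child (in
-- increasing index order) with positive demand.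
sendAgent : ∀ {n} → Tree n → Fin n → ℕ → State n → State n
sendAgent T u t st with isNeg (dS st u)
... | true = record st
      { lS  = upd (lS st) (parent T u) (lS st (parent T u) ++ [ suc t ])
      ; out = out st ++ [ (u , parent T u , t) ]
      ; dS  = upd (dS st) u (dS st u +ℤ + 1) }
... | false with firstB (λ v → isPos (dS st v)) (children T u)
...   | just v = record st
      { lS  = upd (lS st) v (lS st v ++ [ suc t ])
      ; out = out st ++ [ (u , v , t) ]
      ; dS  = upd (dS st) v (dS st v -ℤ + 1) }
...   | nothing = st

-- process_subtree(u), with fuel bounding the recursion depth
-- (fuel n suffices since the tree has depth < n).
processSubtree : ∀ {n k} → Instance n k → ℕ → Fin n → State n → State n
processSubtree I zero u st = st
processSubtree {n} I (suc f) u st = st5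
  where
    T = tree I
    st1 : State n
    st1 = if agent I u then record st { lS = upd (lS st) u (sS st u ∷ lS st u) } else st
    phase1 : State n → Fin n → State n
    phase1 σ v = if isNeg (dS σ v)
                 then processSubtree I f v
                        (record σ { sS = upd (sS σ) v ((sS σ u ∸ 1) ⊔ maxList (lS σ u) ⊔ 0) })
                 else σ
    st2 : State n
    st2 = foldl phase1 st1 (children T u)
    st3 : State n
    st3 = foldl (λ σ t → sendAgent T u t σ) st2 (lS st2 u)
    st4 : State n
    st4 = record st3 { proc = upd (proc st3) u true }
    phase2 : State n → Fin n → State n
    phase2 σ v = if proc σ v then σ else processSubtree I f v σ
    st5 : State n
    st5 = foldl phase2 st4 (children T u)

initState : ∀ {n k} → Instance n k → State n
initState I = record
  { dS = demand I ; lS = λ _ → [] ; sS = λ _ → 0 ; proc = λ _ → false ; out = [] }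

plan : ∀ {n k} → Instance n k → List (Move n)
plan {n} I = out (processSubtree I n (root (tree I)) (initState I))

-- Each agent is tracked as (current position , time of last arrival).
-- At each time t every agent at node p whose node has an outgoing move
-- (p , v , t) moves to v, arriving at t+1; otherwise it waits.

moveFrom : ∀ {n} → List (Move n) → Fin n → ℕ → Maybe (Fin n)
moveFrom [] p t = nothing
moveFrom ((u , v , t') ∷ ms) p t =
  if (u == p) ∧ (t' ≡ᵇ t) then just v else moveFrom ms p t

stepAgent : ∀ {n} → List (Move n) → ℕ → Fin n × ℕ → Fin n × ℕ
stepAgent ms t (p , la) with moveFrom ms p t
... | just v  = (v , suc t)
... | nothing = (p , la)

horizon : ∀ {n} → List (Move n) → ℕ
horizon ms = suc (foldr (λ m acc → proj₂ (proj₂ m) ⊔ acc) 0 ms)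

-- path length of each agent = time at which it reaches its final node for
-- the last time (0 if it never moves)
pathLengths : ∀ {n k} → Instance n k → List ℕ
pathLengths {n} I =
  map proj₂
    (foldl (λ ags t → map (stepAgent (plan I) t) ags)
           (map (λ p → (p , 0)) (filterB (agent I) (allFin n)))
           (upTo (horizon (plan I))))

makespan : ∀ {n k} → Instance n k → ℕ
makespan I = maxList (pathLengths I)

sumOfCosts : ∀ {n k} → Instance n k → ℕ
sumOfCosts I = sum (pathLengths I)

Config : ℕ → Set
Config n = Fin n → Bool

moveConf : ∀ {n} → Config n → Fin n → Fin n → Config n
moveConf c u v = upd (upd c u false) v true

data Reach {n : ℕ} (T : Tree n) (goal : Config n) : Config n → ℕ → Set where
  done : ∀ {c} → (∀ i → c i ≡ goal i) → Reach T goal c 0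
  step : ∀ {c m} (u v : Fin n) → Adjacent T u v → c u ≡ true → c v ≡ false
       → Reach T goal (moveConf c u v) m → Reach T goal c (suc m)

OPTis : ∀ {n k} → Instance n k → ℕ → Set
OPTis I m = Reach (tree I) (target I) (agent I) m
          × (∀ m' → Reach (tree I) (target I) (agent I) m' → m ≤ m')

module Submission where

-- The instance is the path 0 — 1 — ⋯ — (n − 1) with agents on the first k nodes
-- and targets on the last k.  A move changes the sum of the occupied positions by
-- at most one and this sum has to grow by k·g, where g = n − k, so OPT ≥ k·g;
-- conversely, sliding a hole from the front of the block of pebbles to its back
-- shifts the block by one node in k moves, so k·g moves suffice.
-- Every demand on the path is non-negative, so process_subtree never sends an
-- agent upwards: walking down the path, it makes every node of the block
-- [t, t + k) send its agent one step forward at each time t < g.  Thus every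
-- agent moves at each of the times 0, …, g − 1 and then stays, its path length
-- is g, and the makespan and sum of costs are g and k·g.

open import Defs
open import Algebra.Bundles using (Monoid)
import Algebra.Properties.CommutativeMonoid.Sum as CommutativeMonoidSum
import Algebra.Properties.Monoid.Sum as MonoidSum
open import Data.Bool using (Bool; true; false; if_then_else_; _∧_; not)
open import Data.Bool.Properties using (∧-zeroʳ; ∧-identityʳ; T-≡)
open import Data.Fin using (Fin; zero; suc; toℕ; fromℕ<; inject₁; pred)
open import Data.Fin.Properties using (toℕ-injective; toℕ<n; toℕ-fromℕ<; toℕ-inject₁; punchInᵢ≢i)
  renaming (_≟_ to _≟ᶠ_)
open import Data.Integer using (ℤ; +_) renaming (_+_ to _+ℤ_; _-_ to _-ℤ_)
import Data.Integer.Properties as ℤ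
open import Data.List
  using (List; []; _∷_; _++_; [_]; map; foldl; foldr; tabulate; allFin; take; length; replicate; upTo)
open import Data.List.Membership.Propositional using (_∈_)
open import Data.List.Membership.Propositional.Properties using (∈-++⁻; ∈-++⁺ˡ; ∈-++⁺ʳ; ∈-map⁻; ∈-map⁺)
open import Data.List.Properties
  using (map-tabulate; ++-assoc; ++-identityʳ; take-[]; map-id; map-∘; foldl-++; upTo-∷ʳ)
open import Data.List.Relation.Unary.Any using (here; there)
open import Data.Maybe using (just; nothing)
open import Data.Nat
  using (ℕ; zero; suc; _+_; _*_; _∸_; _⊓_; _⊔_; _≤_; _<_; _≤ᵇ_; _<ᵇ_; _≡ᵇ_; z≤n; s≤s; s≤s⁻¹; z<s; >-nonZero)
import Data.Nat as ℕ
open import Data.Nat.ListAction using (sum)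
open import Data.Nat.Properties
open import Data.Product using (Σ; _×_; _,_; proj₁; proj₂; ∃-syntax)
open import Data.Sum using (inj₁; inj₂)
open import Data.Vec.Functional using (removeAt)
open import Function using (_∘_)
open import Function.Bundles using (mk⇔; Equivalence)
open import Relation.Binary.PropositionalEquality
  using (_≡_; _≢_; _≗_; refl; sym; trans; cong; cong₂; subst; module ≡-Reasoning)
import Relation.Binary.Reasoning.Setoid as SetoidReasoning
open import Relation.Nullary.Decidable using (dec-true; dec-false; does-⇔; yes; no)
open import Relation.Nullary.Negation using (¬_; contradiction)

==-refl : ∀ {n} (i : Fin n) → (i == i) ≡ true
==-refl i = dec-true (i ≟ᶠ i) refl

==-≢ : ∀ {n} {i j : Fin n} → i ≢ j → (i == j) ≡ false
==-≢ {i = i} {j} = dec-false (i ≟ᶠ j)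

module _ {n : ℕ} {A : Set} (f : Fin n → A) (i : Fin n) (a : A) where

  upd-≡ : upd f i a i ≡ a
  upd-≡ rewrite ==-refl i = refl

  upd-≢ : ∀ {j} → j ≢ i → upd f i a j ≡ f j
  upd-≢ j≢i rewrite ==-≢ j≢i = refl

moveConf-cong : ∀ {n} {c c′ : Config n} u v → c ≗ c′ → moveConf c u v ≗ moveConf c′ u v
moveConf-cong u v c≗c′ i = cong (λ b → if i == v then true else (if i == u then false else b)) (c≗c′ i)

module _ {n : ℕ} {T : Tree n} where

  Reach-≗ : ∀ {goal goal′ c c′ : Config n} {m} → goal ≗ goal′ → c ≗ c′ →
            Reach T goal c m → Reach T goal′ c′ m
  Reach-≗ goal≗ c≗ (done c≗goal) = done (λ i → trans (sym (c≗ i)) (trans (c≗goal i) (goal≗ i)))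
  Reach-≗ goal≗ c≗ (step u v adj cu cv r) =
    step u v adj (trans (sym (c≗ u)) cu) (trans (sym (c≗ v)) cv) (Reach-≗ goal≗ (moveConf-cong u v c≗) r)

  Reach-trans : ∀ {goal mid c : Config n} {m₁ m₂} →
                Reach T mid c m₁ → Reach T goal mid m₂ → Reach T goal c (m₁ + m₂)
  Reach-trans (done c≗mid) r = Reach-≗ (λ _ → refl) (λ i → sym (c≗mid i)) r
  Reach-trans (step u v adj cu cv r₁) r₂ = step u v adj cu cv (Reach-trans r₁ r₂)

module IndexedSums {c ℓ} (M : Monoid c ℓ) where
  open Monoid M using (Carrier; _≈_; _∙_; ε; setoid; identityˡ; identityʳ; assoc; ∙-congˡ; ∙-congʳ)
    renaming (sym to ≈-sym; trans to ≈-trans)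
  open MonoidSum M using (sum-syntax; sum-cong-≗; sum-replicate-zero)

  ∑-toℕ-+ : ∀ m r (h : ℕ → Carrier) →
            ∑[ i < m + r ] h (toℕ i) ≈ ∑[ i < m ] h (toℕ i) ∙ ∑[ i < r ] h (m + toℕ i)
  ∑-toℕ-+ zero    r h = ≈-sym (identityˡ _)
  ∑-toℕ-+ (suc m) r h = ≈-trans (∙-congˡ (∑-toℕ-+ m r (h ∘ suc))) (≈-sym (assoc _ _ _))

  ∑-toℕ-cong : ∀ {m} {h h′ : ℕ → Carrier} → (∀ j → j < m → h j ≡ h′ j) →
               ∑[ i < m ] h (toℕ i) ≡ ∑[ i < m ] h′ (toℕ i)
  ∑-toℕ-cong h≡h′ = sum-cong-≗ (λ i → h≡h′ (toℕ i) (toℕ<n i))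

  ∑-toℕ-below : ∀ m r (h : ℕ → Carrier) →
    ∑[ i < m + r ] (if toℕ i <ᵇ m then h (toℕ i) else ε) ≈ ∑[ i < m ] h (toℕ i)
  ∑-toℕ-below m r h = begin
    ∑[ i < m + r ] f (toℕ i)                          ≈⟨ ∑-toℕ-+ m r f ⟩
    ∑[ i < m ] f (toℕ i) ∙ ∑[ i < r ] f (m + toℕ i)  ≡⟨ cong₂ _∙_ (∑-toℕ-cong below) (∑-toℕ-cong above) ⟩
    ∑[ i < m ] h (toℕ i) ∙ ∑[ i < r ] ε              ≈⟨ ∙-congˡ (sum-replicate-zero r) ⟩
    ∑[ i < m ] h (toℕ i) ∙ ε                          ≈⟨ identityʳ _ ⟩
    ∑[ i < m ] h (toℕ i)                              ∎
    where
    open SetoidReasoning setoid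
    f : ℕ → Carrier
    f j = if j <ᵇ m then h j else ε
    below : ∀ j → j < m → f j ≡ h j
    below j j<m rewrite dec-true (j <? m) j<m = refl
    above : ∀ j → j < r → f (m + j) ≡ ε
    above j _ rewrite dec-false (m + j <? m) (m+n≮m m j) = refl

  ∑-toℕ-from : ∀ m r (h : ℕ → Carrier) →
    ∑[ i < m + r ] (if m ≤ᵇ toℕ i then h (toℕ i) else ε) ≈ ∑[ i < r ] h (m + toℕ i)
  ∑-toℕ-from m r h = begin
    ∑[ i < m + r ] f (toℕ i)                          ≈⟨ ∑-toℕ-+ m r f ⟩
    ∑[ i < m ] f (toℕ i) ∙ ∑[ i < r ] f (m + toℕ i)  ≡⟨ cong₂ _∙_ (∑-toℕ-cong below) (∑-toℕ-cong above) ⟩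
    ∑[ i < m ] ε ∙ ∑[ i < r ] h (m + toℕ i)          ≈⟨ ∙-congʳ (sum-replicate-zero m) ⟩
    ε ∙ ∑[ i < r ] h (m + toℕ i)                      ≈⟨ identityˡ _ ⟩
    ∑[ i < r ] h (m + toℕ i)                          ∎
    where
    open SetoidReasoning setoid
    f : ℕ → Carrier
    f j = if m ≤ᵇ j then h j else ε
    below : ∀ j → j < m → f j ≡ ε
    below j j<m rewrite dec-false (m ≤? j) (<⇒≱ j<m) = refl
    above : ∀ j → j < r → f (m + j) ≡ h (m + j)
    above j _ rewrite dec-true (m ≤? m + j) (m≤m+n m j) = refl

open CommutativeMonoidSum +-0-commutativeMonoid
  using (sum-syntax; sum-cong-≗; sum-remove; ∑-distrib-+)
  renaming (sum to ∑)
open IndexedSums +-0-monoid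

-- A potential bound on the number of moves

∑-update : ∀ {n} (f f′ : Fin n → ℕ) (i : Fin n) → (∀ j → j ≢ i → f′ j ≡ f j) →
           ∑ f′ + f i ≡ ∑ f + f′ i
∑-update {suc _} f f′ i agree = begin
  ∑ f′ + f i                    ≡⟨ cong (_+ f i) (sum-remove {i = i} f′) ⟩
  f′ i + ∑ (removeAt f′ i) + f i ≡⟨ cong (λ r → f′ i + r + f i) rest ⟩
  f′ i + r + f i                 ≡⟨ +-assoc (f′ i) r (f i) ⟩
  f′ i + (r + f i)               ≡⟨ +-comm (f′ i) (r + f i) ⟩
  r + f i + f′ i                 ≡⟨ cong (_+ f′ i) (+-comm r (f i)) ⟩
  f i + r + f′ i                 ≡⟨ cong (_+ f′ i) (sum-remove {i = i} f) ⟨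
  ∑ f + f′ i                    ∎
  where
  open ≡-Reasoning
  r : ℕ
  r = ∑ (removeAt f i)
  rest : ∑ (removeAt f′ i) ≡ r
  rest = sum-cong-≗ (λ j → agree _ (punchInᵢ≢i i j))

potential : ∀ {n} → (Fin n → ℕ) → Config n → ℕ
potential {n} h c = ∑[ i < n ] (if c i then h i else 0)

potential-upd : ∀ {n} (h : Fin n → ℕ) (c : Config n) i b →
  potential h (upd c i b) + (if c i then h i else 0) ≡ potential h c + (if b then h i else 0)
potential-upd h c i b =
  trans (∑-update _ _ i λ j j≢i → cong (weight j) (upd-≢ c i b j≢i))
        (cong (λ b′ → potential h c + weight i b′) (upd-≡ c i b))
  where
  weight : ∀ j → Bool → ℕ
  weight j b′ = if b′ then h j else 0

potential-moveConf : ∀ {n} (h : Fin n → ℕ) (c : Config n) u v → c u ≡ true → c v ≡ false →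
                     potential h (moveConf c u v) + h u ≡ potential h c + h v
potential-moveConf {n} h c u v cu cv = begin
  potential h c₂ + h u           ≡⟨ cong (_+ h u) (trans (sym (+-identityʳ _)) lift) ⟩
  potential h c₁ + h v + h u     ≡⟨ +-assoc (potential h c₁) (h v) (h u) ⟩
  potential h c₁ + (h v + h u)   ≡⟨ cong (_+_ (potential h c₁)) (+-comm (h v) (h u)) ⟩
  potential h c₁ + (h u + h v)   ≡⟨ +-assoc (potential h c₁) (h u) (h v) ⟨
  potential h c₁ + h u + h v     ≡⟨ cong (_+ h v) (trans lower (+-identityʳ _)) ⟩
  potential h c + h v            ∎
  where
  open ≡-Reasoning
  c₁ c₂ : Config n
  c₁ = upd c u false
  c₂ = upd c₁ v true
  lower : potential h c₁ + h u ≡ potential h c + 0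
  lower = subst (λ b → potential h c₁ + (if b then h u else 0) ≡ potential h c + 0) cu
                (potential-upd h c u false)
  v≢u : v ≢ u
  v≢u refl with () ← trans (sym cu) cv
  lift : potential h c₂ + 0 ≡ potential h c₁ + h v
  lift = subst (λ b → potential h c₂ + (if b then h v else 0) ≡ potential h c₁ + h v)
               (trans (upd-≢ c u false v≢u) cv) (potential-upd h c₁ v true)

module _ {n : ℕ} (T : Tree n) (h : Fin n → ℕ) (h-adj : ∀ {u v} → Adjacent T u v → h v ≤ suc (h u)) where

  potential-step : ∀ c u v → Adjacent T u v → c u ≡ true → c v ≡ false →
                   potential h (moveConf c u v) ≤ suc (potential h c)
  potential-step c u v adj cu cv = +-cancelʳ-≤ (h u) _ _ (begin
    potential h (moveConf c u v) + h u ≡⟨ potential-moveConf h c u v cu cv ⟩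
    potential h c + h v                ≤⟨ +-monoʳ-≤ (potential h c) (h-adj adj) ⟩
    potential h c + suc (h u)          ≡⟨ +-suc (potential h c) (h u) ⟩
    suc (potential h c) + h u          ∎)
    where open ≤-Reasoning

  Reach⇒potential-≤ : ∀ {goal c m} → Reach T goal c m → potential h goal ≤ potential h c + m
  Reach⇒potential-≤ {goal} {c} (done c≗goal) = ≤-reflexive (begin
    potential h goal ≡⟨ sum-cong-≗ (λ i → cong (λ b → if b then h i else 0) (sym (c≗goal i))) ⟩
    potential h c    ≡⟨ +-identityʳ _ ⟨
    potential h c + 0 ∎)
    where open ≡-Reasoning
  Reach⇒potential-≤ {goal} {c} {suc m} (step u v adj cu cv r) = begin
    potential h goal                       ≤⟨ Reach⇒potential-≤ r ⟩
    potential h (moveConf c u v) + m       ≤⟨ +-monoˡ-≤ m (potential-step c u v adj cu cv) ⟩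
    suc (potential h c) + m                ≡⟨ +-suc (potential h c) m ⟨
    potential h c + suc m                  ∎
    where open ≤-Reasoning

filterB-tabulate-none : ∀ {A : Set} {n} (p : A → Bool) (f : Fin n → A) →
                        (∀ i → p (f i) ≡ false) → filterB p (tabulate f) ≡ []
filterB-tabulate-none {n = zero}  p f none = refl
filterB-tabulate-none {n = suc n} p f none rewrite none zero =
  filterB-tabulate-none p (f ∘ suc) (none ∘ suc)

filterB-tabulate-only : ∀ {A : Set} {n} (p : A → Bool) (f : Fin n → A) (w : Fin n) →
                        (∀ i → p (f i) ≡ (i == w)) → filterB p (tabulate f) ≡ [ f w ]
filterB-tabulate-only p f zero only rewrite only zero =
  cong (f zero ∷_) (filterB-tabulate-none p (f ∘ suc) (only ∘ suc))
filterB-tabulate-only p f (suc w) only rewrite only zero =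
  filterB-tabulate-only p (f ∘ suc) w (only ∘ suc)

path : ∀ {m} → Tree (suc m)
path = record { root = zero ; root-zero = refl ; parent = pred ; parent-lt = pred< }
  where
  pred< : ∀ {m} (i : Fin (suc m)) → 0 < toℕ i → toℕ (pred i) < toℕ i
  pred< (suc i) _ = s≤s (≤-reflexive (toℕ-inject₁ i))

module _ {m : ℕ} where

  toℕ-pred : ∀ (i : Fin (suc m)) → toℕ (pred i) ≡ ℕ.pred (toℕ i)
  toℕ-pred zero    = refl
  toℕ-pred (suc i) = toℕ-inject₁ i

  path-adjacent-≤ : ∀ {u v : Fin (suc m)} → Adjacent path u v → toℕ v ≤ suc (toℕ u)
  path-adjacent-≤ {u} (inj₁ (_ , refl)) rewrite toℕ-pred u = m≤n⇒m≤1+n pred[n]≤n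
  path-adjacent-≤ {v = v} (inj₂ (0<v , refl)) rewrite toℕ-pred v =
    ≤-reflexive (sym (suc-pred (toℕ v) {{>-nonZero 0<v}}))

  path-ancestors : ∀ f (u v : Fin (suc m)) → toℕ v ≤ f →
                   anyB (_== u) (ancestorsF path f v) ≡ (toℕ u ≤ᵇ toℕ v)
  path-ancestors zero    zero    zero    _ = refl
  path-ancestors zero    (suc u) zero    _ = refl
  path-ancestors (suc f) zero    zero    _ = refl
  path-ancestors (suc f) (suc u) zero    _ = refl
  path-ancestors (suc f) u (suc v) (s≤s v≤f)
    rewrite path-ancestors f u (inject₁ v) (subst (_≤ f) (sym (toℕ-inject₁ v)) v≤f) | toℕ-inject₁ v
    with suc v ≟ᶠ u
  ... | yes refl = sym (dec-true (suc (toℕ v) ≤? suc (toℕ v)) ≤-refl)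
  ... | no v≢u   = does-⇔ (mk⇔ m≤n⇒m≤1+n ≤suc⇒≤) (toℕ u ≤? toℕ v) (toℕ u ≤? suc (toℕ v))
    where
    ≤suc⇒≤ : toℕ u ≤ suc (toℕ v) → toℕ u ≤ toℕ v
    ≤suc⇒≤ u≤ = s≤s⁻¹ (≤∧≢⇒< u≤ (λ eq → v≢u (toℕ-injective (sym eq))))

  path-inSubtree : ∀ (u v : Fin (suc m)) → inSubtree path u v ≡ (toℕ u ≤ᵇ toℕ v)
  path-inSubtree u v = path-ancestors (suc m) u v (<⇒≤ (toℕ<n v))

  path-children-next : ∀ (u v : Fin (suc m)) → toℕ v ≡ suc (toℕ u) → children path u ≡ [ v ]
  path-children-next u (suc v) v≡1+u = filterB-tabulate-only _ (λ i → i) (suc v) child⇔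
    where
    toℕ-v≡u : toℕ v ≡ toℕ u
    toℕ-v≡u = suc-injective v≡1+u
    child⇔ : ∀ i → (not (isRoot i) ∧ (pred i == u)) ≡ (i == suc v)
    child⇔ zero    = refl
    child⇔ (suc i) = does-⇔ (mk⇔ to from) (inject₁ i ≟ᶠ u) (i ≟ᶠ v)
      where
      to : inject₁ i ≡ u → i ≡ v
      to eq = toℕ-injective (trans (sym (toℕ-inject₁ i)) (trans (cong toℕ eq) (sym toℕ-v≡u)))
      from : i ≡ v → inject₁ i ≡ u
      from eq = toℕ-injective (trans (toℕ-inject₁ i) (trans (cong toℕ eq) toℕ-v≡u))

  path-children-last : ∀ (u : Fin (suc m)) → toℕ u ≡ m → children path u ≡ []
  path-children-last u u≡m = filterB-tabulate-none _ (λ i → i) no-child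
    where
    no-child : ∀ i → (not (isRoot i) ∧ (pred i == u)) ≡ false
    no-child zero    = refl
    no-child (suc i) = ==-≢ λ eq → <-irrefl (trans (sym (toℕ-inject₁ i)) (trans (cong toℕ eq) u≡m)) (toℕ<n i)

-- Sliding a hole along the path

without : ∀ {n} → Config n → Fin n → Config n
without B h i = B i ∧ not (i == h)

moveConf-without : ∀ {n} (B : Config n) u v → B v ≡ true → u ≢ v →
                   moveConf (without B v) u v ≗ without B u
moveConf-without B u v Bv u≢v j with j ≟ᶠ v | j ≟ᶠ u
... | yes refl | yes refl = contradiction refl u≢v
... | yes refl | no _     = sym (trans (∧-identityʳ _) Bv)
... | no _     | yes refl = sym (∧-zeroʳ _)
... | no _     | no _     = refl

slide-hole : ∀ {m} (B : Config (suc m)) (u v : Fin (suc m)) r → toℕ v ≡ toℕ u + r →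
             (∀ i → toℕ u ≤ toℕ i → toℕ i ≤ toℕ v → B i ≡ true) →
             Reach path (without B u) (without B v) r
slide-hole B u v zero v≡u _ with toℕ-injective (trans v≡u (+-identityʳ _))
... | refl = done (λ _ → refl)
slide-hole B u zero (suc r) 0≡u+1+r _ with () ← trans 0≡u+1+r (+-suc (toℕ u) r)
slide-hole B u (suc w) (suc r) v≡u+1+r filled =
  step (inject₁ w) (suc w) (inj₂ (s≤s z≤n , refl)) filled-w hole-v
    (Reach-≗ (λ _ → refl) (λ i → sym (moveConf-without B (inject₁ w) (suc w) B-v w≢v i))
      (slide-hole B u (inject₁ w) r w≡u+r (λ i u≤i i≤w → filled i u≤i (m≤n⇒m≤1+n (≤-trans i≤w w≤w)))))
  where
  w≡u+r : toℕ (inject₁ w) ≡ toℕ u + r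
  w≡u+r = trans (toℕ-inject₁ w) (suc-injective (trans v≡u+1+r (+-suc (toℕ u) r)))
  w≤w : toℕ (inject₁ w) ≤ toℕ w
  w≤w = ≤-reflexive (toℕ-inject₁ w)
  w≢v : inject₁ w ≢ suc w
  w≢v eq = <-irrefl (cong toℕ eq) (s≤s w≤w)
  B-v : B (suc w) ≡ true
  B-v = filled (suc w) (≤-trans (m≤m+n (toℕ u) (suc r)) (≤-reflexive (sym v≡u+1+r))) ≤-refl
  filled-w : without B (suc w) (inject₁ w) ≡ true
  filled-w rewrite ==-≢ w≢v = trans (∧-identityʳ _)
    (filled (inject₁ w) (≤-trans (m≤m+n (toℕ u) r) (≤-reflexive (sym w≡u+r))) (m≤n⇒m≤1+n w≤w))
  hole-v : without B (suc w) (suc w) ≡ false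
  hole-v rewrite ==-refl (suc w) = ∧-zeroʳ _

nodesIn : ∀ {n} → ℕ → ℕ → Config n
nodesIn a b i = (a ≤ᵇ toℕ i) ∧ (toℕ i <ᵇ b)

module _ {n : ℕ} {a b : ℕ} where

  nodesIn-∋ : ∀ (i : Fin n) → a ≤ toℕ i → toℕ i < b → nodesIn a b i ≡ true
  nodesIn-∋ i a≤i i<b rewrite dec-true (a ≤? toℕ i) a≤i | dec-true (toℕ i <? b) i<b = refl

  without-last : ∀ (h : Fin n) → toℕ h ≡ b → without (nodesIn a (suc b)) h ≗ nodesIn a b
  without-last h h≡b j with j ≟ᶠ h
  ... | yes refl rewrite dec-false (toℕ j <? b) (<-irrefl h≡b) = trans (∧-zeroʳ _) (sym (∧-zeroʳ _))
  ... | no j≢h   = trans (∧-identityʳ _)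
    (cong ((a ≤ᵇ toℕ j) ∧_)
          (does-⇔ (mk⇔ (λ j<1+b → ≤∧≢⇒< (s≤s⁻¹ j<1+b) j≢b) m≤n⇒m≤1+n) (toℕ j <? suc b) (toℕ j <? b)))
    where
    j≢b : toℕ j ≢ b
    j≢b eq = j≢h (toℕ-injective (trans eq (sym h≡b)))

  without-first : ∀ (h : Fin n) → toℕ h ≡ a → without (nodesIn a b) h ≗ nodesIn (suc a) b
  without-first h h≡a j with j ≟ᶠ h
  ... | yes refl rewrite dec-false (suc a ≤? toℕ j) (<-irrefl (sym h≡a)) = ∧-zeroʳ _
  ... | no j≢h   = trans (∧-identityʳ _)
    (cong (_∧ (toℕ j <ᵇ b)) (does-⇔ (mk⇔ (λ a≤j → ≤∧≢⇒< a≤j a≢j) <⇒≤) (a ≤? toℕ j) (suc a ≤? toℕ j)))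
    where
    a≢j : a ≢ toℕ j
    a≢j eq = j≢h (toℕ-injective (trans (sym eq) (sym h≡a)))

sum-tabulate : ∀ {n} (f : Fin n → ℕ) → sum (tabulate f) ≡ ∑ f
sum-tabulate {zero}  f = refl
sum-tabulate {suc n} f = cong (_+_ (f zero)) (sum-tabulate (f ∘ suc))

count≡∑ : ∀ {n} (c : Config n) → count c ≡ ∑[ i < n ] (if c i then 1 else 0)
count≡∑ {n} c = trans (cong sum (map-tabulate (λ i → i) indicator)) (sum-tabulate indicator)
  where
  indicator : Fin n → ℕ
  indicator i = if c i then 1 else 0

∑-const : ∀ m c → ∑[ i < m ] c ≡ m * c
∑-const zero    c = refl
∑-const (suc m) c = cong (_+_ c) (∑-const m c)

∑-toℕ-+-comm : ∀ a b (h : ℕ → ℕ) → ∑[ i < a + b ] h (toℕ i) ≡ ∑[ i < b + a ] h (toℕ i)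
∑-toℕ-+-comm a b h = cong (λ N → ∑[ i < N ] h (toℕ i)) (+-comm a b)

module ℤ∑ = MonoidSum ℤ.+-0-monoid
module ℤIndexedSums = IndexedSums ℤ.+-0-monoid

foldr-select-tabulate : ∀ {m N} (P : Fin N → Bool) (w : Fin N → ℤ) (f : Fin m → Fin N) →
  foldr (λ v acc → if P v then w v +ℤ acc else acc) (+ 0) (tabulate f) ≡
  ℤ∑.sum (λ i → if P (f i) then w (f i) else + 0)
foldr-select-tabulate {zero}  P w f = refl
foldr-select-tabulate {suc m} P w f with P (f zero)
... | true  = cong (w (f zero) +ℤ_) (foldr-select-tabulate P w (f ∘ suc))
... | false = trans (foldr-select-tabulate P w (f ∘ suc)) (sym (ℤ.+-identityˡ _))

demand≡∑ : ∀ {n k} (I : Instance n k) u →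
  demand I u ≡ ℤ∑.sum (λ v → if inSubtree (tree I) u v then b2ℤ (target I v) -ℤ b2ℤ (agent I v) else + 0)
demand≡∑ I u = foldr-select-tabulate (inSubtree (tree I) u) _ (λ i → i)

b2ℤ-balance : ∀ t a D D′ → D + (if a then 1 else 0) ≡ (if t then 1 else 0) + D′ →
              (b2ℤ t -ℤ b2ℤ a) +ℤ + D′ ≡ + D
b2ℤ-balance false false D D′ eq = cong +_ (sym (trans (sym (+-identityʳ D)) eq))
b2ℤ-balance true  false D D′ eq = cong +_ (sym (trans (sym (+-identityʳ D)) eq))
b2ℤ-balance false true  D D′ eq rewrite sym eq | +-comm D 1 = ℤ.⊖-≥ (s≤s z≤n)
b2ℤ-balance true  true  D D′ eq = cong +_ (sym (+-cancelˡ-≡ 1 D D′ (trans (+-comm 1 D) eq)))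

-- Copies of the where-clauses of processSubtree, so that one unfolding step can be stated;
-- in pushStart the conditional is moved inside the record, so that only lS depends on it.
module Unfolding {n k : ℕ} (I : Instance n k) where

  pushStart : Fin n → State n → State n
  pushStart u σ = record σ { lS = if agent I u then upd (lS σ) u (sS σ u ∷ lS σ u) else lS σ }

  descend : ℕ → Fin n → State n → Fin n → State n
  descend f u σ v = if isNeg (dS σ v)
                    then processSubtree I f v
                           (record σ { sS = upd (sS σ) v ((sS σ u ∸ 1) ⊔ maxList (lS σ u) ⊔ 0) })
                    else σ

  sendAll : Fin n → State n → State n
  sendAll u σ = foldl (λ σ′ t → sendAgent (tree I) u t σ′) σ (lS σ u)

  markProcessed : Fin n → State n → State n
  markProcessed u σ = record σ { proc = upd (proc σ) u true }

  visit : ℕ → State n → Fin n → State n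
  visit f σ v = if proc σ v then σ else processSubtree I f v σ

  processSubtree-unfold : ∀ f u σ → processSubtree I (suc f) u σ ≡
    foldl (visit f) (markProcessed u (sendAll u (foldl (descend f u) (pushStart u σ) (children (tree I) u))))
          (children (tree I) u)
  processSubtree-unfold f u σ = cong continue start≡pushStart
    where
    continue : State n → State n
    continue σ₁ = foldl (visit f) (markProcessed u (sendAll u (foldl (descend f u) σ₁ (children (tree I) u))))
                        (children (tree I) u)
    start≡pushStart : (if agent I u then record σ { lS = upd (lS σ) u (sS σ u ∷ lS σ u) } else σ) ≡
                      record σ { lS = if agent I u then upd (lS σ) u (sS σ u ∷ lS σ u) else lS σ }
    start≡pushStart with agent I u
    ... | true  = refl
    ... | false = refl

  descend-nonneg : ∀ f u σ v → isNeg (dS σ v) ≡ false → descend f u σ v ≡ σ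
  descend-nonneg f u σ v nonneg rewrite nonneg = refl

  visit-unprocessed : ∀ f σ v → proc σ v ≡ false → visit f σ v ≡ processSubtree I f v σ
  visit-unprocessed f σ v unprocessed rewrite unprocessed = refl

  pushStart-here : ∀ u σ → lS (pushStart u σ) u ≡ (if agent I u then sS σ u ∷ lS σ u else lS σ u)
  pushStart-here u σ with agent I u
  ... | true  = upd-≡ (lS σ) u _
  ... | false = refl

  pushStart-elsewhere : ∀ u σ {j} → j ≢ u → lS (pushStart u σ) j ≡ lS σ j
  pushStart-elsewhere u σ j≢u with agent I u
  ... | true  = upd-≢ (lS σ) u _ j≢u
  ... | false = refl

module _ {n : ℕ} (T : Tree n) {X : Fin n} where

  sendAgent-leaf : children T X ≡ [] → ∀ t σ → isNeg (dS σ X) ≡ false → sendAgent T X t σ ≡ σ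
  sendAgent-leaf leaf t σ nonneg with isNeg (dS σ X)
  sendAgent-leaf leaf t σ refl | false rewrite leaf = refl

  sendAll-leaf : children T X ≡ [] → ∀ ts σ → isNeg (dS σ X) ≡ false →
                 foldl (λ σ′ t → sendAgent T X t σ′) σ ts ≡ σ
  sendAll-leaf leaf []       σ nonneg = refl
  sendAll-leaf leaf (t ∷ ts) σ nonneg rewrite sendAgent-leaf leaf t σ nonneg = sendAll-leaf leaf ts σ nonneg

module _ {n : ℕ} (T : Tree n) {X X1 : Fin n} (only-child : children T X ≡ [ X1 ]) where

  sendAgent-idle : ∀ t σ → isNeg (dS σ X) ≡ false → dS σ X1 ≡ + 0 → sendAgent T X t σ ≡ σ
  sendAgent-idle t σ nonneg _ with isNeg (dS σ X)
  sendAgent-idle t σ refl idle | false rewrite only-child | cong isPos idle = refl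

  sendAgent-child : ∀ t σ D → isNeg (dS σ X) ≡ false → dS σ X1 ≡ + suc D →
    sendAgent T X t σ ≡ record σ
      { lS  = upd (lS σ) X1 (lS σ X1 ++ [ suc t ])
      ; out = out σ ++ [ (X , X1 , t) ]
      ; dS  = upd (dS σ) X1 (dS σ X1 -ℤ + 1) }
  sendAgent-child t σ D nonneg _ with isNeg (dS σ X)
  sendAgent-child t σ D refl wanting | false rewrite only-child | cong isPos wanting = refl

  record Sent (σ σ′ : State n) (ts : List ℕ) : Set where
    field
      proc-same    : proc σ′ ≡ proc σ
      starts-same  : sS σ′ ≡ sS σ
      out-sent     : out σ′ ≡ out σ ++ map (λ t → (X , X1 , t)) ts
      list-child   : lS σ′ X1 ≡ lS σ X1 ++ map suc ts
      list-other   : ∀ {j} → j ≢ X1 → lS σ′ j ≡ lS σ j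
      demand-child : isNeg (dS σ′ X1) ≡ false
      demand-other : ∀ {j} → j ≢ X1 → dS σ′ j ≡ dS σ j

  sendAll-child : X ≢ X1 → ∀ ts D σ → isNeg (dS σ X) ≡ false → dS σ X1 ≡ + D →
                  Sent σ (foldl (λ σ′ t → sendAgent T X t σ′) σ ts) (take D ts)
  sendAll-child X≢X1 [] D σ nonneg demand rewrite take-[] {A = ℕ} D = record
    { proc-same = refl ; starts-same = refl
    ; out-sent = sym (++-identityʳ _) ; list-child = sym (++-identityʳ _) ; list-other = λ _ → refl
    ; demand-child = cong isNeg demand ; demand-other = λ _ → refl }
  sendAll-child X≢X1 (t ∷ ts) zero σ nonneg idle
    rewrite sendAgent-idle t σ nonneg idle = sendAll-child X≢X1 ts zero σ nonneg idle
  sendAll-child X≢X1 (t ∷ ts) (suc D) σ nonneg wanting rewrite sendAgent-child t σ D nonneg wanting = record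
    { proc-same    = R.proc-same
    ; starts-same  = R.starts-same
    ; out-sent     = trans R.out-sent (++-assoc (out σ) _ _)
    ; list-child   = trans R.list-child
                       (trans (cong (_++ _) (upd-≡ (lS σ) X1 _)) (++-assoc (lS σ X1) _ _))
    ; list-other   = λ j≢X1 → trans (R.list-other j≢X1) (upd-≢ (lS σ) X1 _ j≢X1)
    ; demand-child = R.demand-child
    ; demand-other = λ j≢X1 → trans (R.demand-other j≢X1) (upd-≢ (dS σ) X1 _ j≢X1) }
    where
    σ₁ : State n
    σ₁ = record σ
      { lS  = upd (lS σ) X1 (lS σ X1 ++ [ suc t ])
      ; out = out σ ++ [ (X , X1 , t) ]
      ; dS  = upd (dS σ) X1 (dS σ X1 -ℤ + 1) }
    demand₁ : dS σ₁ X1 ≡ + D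
    demand₁ = trans (upd-≡ (dS σ) X1 _) (trans (cong (_-ℤ + 1) wanting) (ℤ.⊖-≥ (s≤s z≤n)))
    module R = Sent (sendAll-child X≢X1 ts D σ₁ (trans (cong isNeg (upd-≢ (dS σ) X1 _ X≢X1)) nonneg) demand₁)

upFrom : ℕ → ℕ → List ℕ
upFrom a zero    = []
upFrom a (suc d) = a ∷ upFrom (suc a) d

take-upFrom : ∀ {d′ d} a → d′ ≤ d → take d′ (upFrom a d) ≡ upFrom a d′
take-upFrom a z≤n       = refl
take-upFrom a (s≤s d′≤d) = cong (a ∷_) (take-upFrom (suc a) d′≤d)

map-suc-upFrom : ∀ a d → map suc (upFrom a d) ≡ upFrom (suc a) d
map-suc-upFrom a zero    = refl
map-suc-upFrom a (suc d) = cong (suc a ∷_) (map-suc-upFrom (suc a) d)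

∈-upFrom⁻ : ∀ {t} a d → t ∈ upFrom a d → a ≤ t × t < a + d
∈-upFrom⁻ a (suc d) (here refl) = ≤-refl , m<m+n a z<s
∈-upFrom⁻ {t} a (suc d) (there t∈) with ∈-upFrom⁻ (suc a) d t∈
... | a<t , t<1+a+d = <⇒≤ a<t , subst (t <_) (sym (+-suc a d)) t<1+a+d

∈-upFrom⁺ : ∀ {t} a d → a ≤ t → t < a + d → t ∈ upFrom a d
∈-upFrom⁺ {t} a zero a≤t t<a+0 = contradiction (subst (t <_) (+-identityʳ a) t<a+0) (≤⇒≯ a≤t)
∈-upFrom⁺ {t} a (suc d) a≤t t<a+1+d with a ≟ t
... | yes refl = here refl
... | no a≢t   = there (∈-upFrom⁺ (suc a) d (≤∧≢⇒< a≤t a≢t) (subst (t <_) (+-suc a d) t<a+1+d))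

moveFrom-∈ : ∀ {n} (ms : List (Move n)) {p t v} → moveFrom ms p t ≡ just v → (p , v , t) ∈ ms
moveFrom-∈ ((u , w , t′) ∷ ms) {p} {t} found with u ≟ᶠ p | t′ ≡ᵇ t in t′≡ᵇt
... | yes refl | true with refl ← ≡ᵇ⇒≡ t′ t (Equivalence.from T-≡ t′≡ᵇt) | refl ← found = here refl
... | yes refl | false = there (moveFrom-∈ ms found)
... | no _     | _     = there (moveFrom-∈ ms found)

moveFrom-∋ : ∀ {n} (ms : List (Move n)) {p v t} → (p , v , t) ∈ ms → ∃[ v′ ] moveFrom ms p t ≡ just v′
moveFrom-∋ ((u , w , t′) ∷ ms) (here refl) rewrite ==-refl u | dec-true (t′ ≟ t′) refl = w , refl
moveFrom-∋ ((u , w , t′) ∷ ms) {p} {t = t} (there m∈) with (u == p) ∧ (t′ ≡ᵇ t)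
... | true  = w , refl
... | false = moveFrom-∋ ms m∈

time<horizon : ∀ {n} {ms : List (Move n)} {u v t} → (u , v , t) ∈ ms → t < horizon ms
time<horizon (here refl)  = s≤s (m≤m⊔n _ _)
time<horizon (there m∈) = ≤-trans (time<horizon m∈) (s≤s (m≤n⊔m _ _))

foldl-map-comm : ∀ {A B : Set} (F : B → A → A) (xs : List A) (ts : List B) →
  foldl (λ ys t → map (F t) ys) xs ts ≡ map (λ x → foldl (λ y t → F t y) x ts) xs
foldl-map-comm F xs []       = sym (map-id xs)
foldl-map-comm F xs (t ∷ ts) = trans (foldl-map-comm F (map (F t) xs) ts) (sym (map-∘ xs))

length-filterB : ∀ {A : Set} (p : A → Bool) xs →
                 length (filterB p xs) ≡ sum (map (λ x → if p x then 1 else 0) xs)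
length-filterB p []       = refl
length-filterB p (x ∷ xs) with p x
... | true  = cong suc (length-filterB p xs)
... | false = length-filterB p xs

map-filterB-const : ∀ {A B : Set} (p : A → Bool) (f : A → B) {c} → (∀ x → p x ≡ true → f x ≡ c) →
                    ∀ xs → map f (filterB p xs) ≡ replicate (length (filterB p xs)) c
map-filterB-const p f f≡c []       = refl
map-filterB-const p f f≡c (x ∷ xs) with p x in px
... | true  = cong₂ _∷_ (f≡c x px) (map-filterB-const p f f≡c xs)
... | false = map-filterB-const p f f≡c xs

maxList-replicate : ∀ m c → maxList (replicate (suc m) c) ≡ c
maxList-replicate zero    c = ⊔-identityʳ c
maxList-replicate (suc m) c = trans (cong (c ⊔_) (maxList-replicate m c)) (⊔-idem c)

sum-replicate : ∀ m c → sum (replicate m c) ≡ m * c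
sum-replicate zero    c = refl
sum-replicate (suc m) c = cong (_+_ c) (sum-replicate m c)

module EndToEnd (k′ g : ℕ) where

  k n : ℕ
  k = suc k′
  n = k + g

  hasAgent hasTarget : ℕ → Bool
  hasAgent x = x <ᵇ k
  hasTarget x = g ≤ᵇ x

  agents targets : Config n
  agents = hasAgent ∘ toℕ
  targets = hasTarget ∘ toℕ

  endToEnd : Instance n k
  endToEnd = record
    { tree = path ; agent = agents ; target = targets
    ; agent-count  = trans (count≡∑ agents)
                       (trans (∑-toℕ-below k g (λ _ → 1)) (trans (∑-const k 1) (*-identityʳ k)))
    ; target-count = trans (count≡∑ targets) (trans (∑-toℕ-+-comm k g (λ j → if g ≤ᵇ j then 1 else 0))
                       (trans (∑-toℕ-from g k (λ _ → 1)) (trans (∑-const k 1) (*-identityʳ k)))) }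

  -- OPT = k·g

  potential-targets : potential toℕ targets ≡ k * g + potential toℕ agents
  potential-targets = begin
    potential toℕ targets                  ≡⟨ ∑-toℕ-+-comm k g (λ j → if g ≤ᵇ j then j else 0) ⟩
    ∑[ i < g + k ] (if g ≤ᵇ toℕ i then toℕ i else 0) ≡⟨ ∑-toℕ-from g k (λ j → j) ⟩
    ∑[ i < k ] (g + toℕ i)                 ≡⟨ ∑-distrib-+ {k} (λ _ → g) toℕ ⟩
    ∑[ i < k ] g + ∑[ i < k ] toℕ i        ≡⟨ cong₂ _+_ (∑-const k g) (sym (∑-toℕ-below k g (λ j → j))) ⟩
    k * g + potential toℕ agents            ∎
    where open ≡-Reasoning

  OPT-lower : ∀ {m} → Reach path targets agents m → k * g ≤ m
  OPT-lower {m} r = +-cancelʳ-≤ (potential toℕ agents) _ _ (begin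
    k * g + potential toℕ agents ≡⟨ potential-targets ⟨
    potential toℕ targets        ≤⟨ Reach⇒potential-≤ path toℕ path-adjacent-≤ r ⟩
    potential toℕ agents + m     ≡⟨ +-comm (potential toℕ agents) m ⟩
    m + potential toℕ agents     ∎)
    where open ≤-Reasoning

  block : ℕ → Config n
  block a = nodesIn a (a + k)

  shift-block : ∀ a → a < g → Reach path (block (suc a)) (block a) k
  shift-block a a<g =
    Reach-≗ (without-first {b = suc (a + k)} bottom (toℕ-fromℕ< a<n))
            (without-last {a = a} top (toℕ-fromℕ< a+k<n))
            (slide-hole window bottom top k top≡bottom+k filled)
    where
    a+k<n : a + k < n
    a+k<n = subst (a + k <_) (+-comm g k) (+-monoˡ-< k a<g)
    a<n : a < n
    a<n = ≤-<-trans (m≤m+n a k) a+k<n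
    bottom top : Fin n
    bottom = fromℕ< a<n
    top = fromℕ< a+k<n
    window : Config n
    window = nodesIn a (suc (a + k))
    top≡bottom+k : toℕ top ≡ toℕ bottom + k
    top≡bottom+k = trans (toℕ-fromℕ< a+k<n) (cong (_+ k) (sym (toℕ-fromℕ< a<n)))
    filled : ∀ i → toℕ bottom ≤ toℕ i → toℕ i ≤ toℕ top → window i ≡ true
    filled i bottom≤i i≤top = nodesIn-∋ i (subst (_≤ toℕ i) (toℕ-fromℕ< a<n) bottom≤i)
                                          (s≤s (subst (toℕ i ≤_) (toℕ-fromℕ< a+k<n) i≤top))

  shift-blocks : ∀ d a → a + d ≡ g → Reach path (block g) (block a) (d * k)
  shift-blocks zero a a+0≡g rewrite sym (trans (sym (+-identityʳ a)) a+0≡g) = done (λ _ → refl)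
  shift-blocks (suc d) a a+1+d≡g =
    Reach-trans (shift-block a (subst (a <_) a+1+d≡g (m<m+n a z<s)))
                (shift-blocks d (suc a) (trans (sym (+-suc a d)) a+1+d≡g))

  OPT-upper : Reach path targets agents (k * g)
  OPT-upper = subst (Reach path targets agents) (*-comm g k)
                    (Reach-≗ block-g≗targets (λ _ → refl) (shift-blocks g 0 refl))
    where
    block-g≗targets : block g ≗ targets
    block-g≗targets i rewrite dec-true (toℕ i <? g + k) (subst (toℕ i <_) (+-comm k g) (toℕ<n i)) =
      ∧-identityʳ _

  OPT : OPTis endToEnd (k * g)
  OPT = OPT-upper , λ _ → OPT-lower

  demandAt : ℕ → ℕ
  demandAt x = (x ⊓ g) ∸ (x ∸ k)

  demand-balance : ∀ x → x < n →
    demandAt x + (if hasAgent x then 1 else 0) ≡ (if hasTarget x then 1 else 0) + demandAt (suc x)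
  demand-balance x x<n with x <? k | x <? g
  ... | yes x<k | yes x<g
    rewrite dec-true (x <? k) x<k | m≤n⇒m∸n≡0 (<⇒≤ x<k) | m≤n⇒m∸n≡0 x<k
          | dec-false (g ≤? x) (<⇒≱ x<g) | m≤n⇒m⊓n≡m (<⇒≤ x<g) | m≤n⇒m⊓n≡m x<g = +-comm x 1
  ... | yes x<k | no x≮g
    rewrite dec-true (x <? k) x<k | m≤n⇒m∸n≡0 (<⇒≤ x<k) | m≤n⇒m∸n≡0 x<k
          | dec-true (g ≤? x) (≮⇒≥ x≮g) | m≥n⇒m⊓n≡n (≮⇒≥ x≮g) | m≥n⇒m⊓n≡n (m≤n⇒m≤1+n (≮⇒≥ x≮g)) = +-comm g 1
  ... | no x≮k | yes x<g
    rewrite dec-false (x <? k) x≮k | +-∸-assoc 1 (≮⇒≥ x≮k)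
          | dec-false (g ≤? x) (<⇒≱ x<g) | m≤n⇒m⊓n≡m (<⇒≤ x<g) | m≤n⇒m⊓n≡m x<g = +-identityʳ _
  ... | no x≮k | no x≮g
    rewrite dec-false (x <? k) x≮k | +-∸-assoc 1 (≮⇒≥ x≮k)
          | dec-true (g ≤? x) (≮⇒≥ x≮g) | m≥n⇒m⊓n≡n (≮⇒≥ x≮g) | m≥n⇒m⊓n≡n (m≤n⇒m≤1+n (≮⇒≥ x≮g)) =
    trans (+-identityʳ _) (+-∸-assoc 1 x∸k<g)
    where
    x∸k<g : x ∸ k < g
    x∸k<g = +-cancelˡ-< k (x ∸ k) g (subst (_< n) (sym (m+[n∸m]≡n (≮⇒≥ x≮k))) x<n)

  demandAt-n : demandAt n ≡ 0
  demandAt-n rewrite m≥n⇒m⊓n≡n (m≤n+m g k) | m+n∸m≡n k g = n∸n≡0 g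

  nodeDemand : ℕ → ℤ
  nodeDemand x = b2ℤ (hasTarget x) -ℤ b2ℤ (hasAgent x)

  tail-demand : ∀ r x → x + r ≡ n → ℤ∑.sum {r} (λ i → nodeDemand (x + toℕ i)) ≡ + demandAt x
  tail-demand zero x x+0≡n rewrite trans (sym (+-identityʳ x)) x+0≡n | demandAt-n = refl
  tail-demand (suc r) x x+1+r≡n = begin
    nodeDemand (x + 0) +ℤ ℤ∑.sum {r} (λ i → nodeDemand (x + suc (toℕ i)))
      ≡⟨ cong₂ _+ℤ_ (cong nodeDemand (+-identityʳ x))
                    (ℤ∑.sum-cong-≗ {r} (λ i → cong nodeDemand (+-suc x (toℕ i)))) ⟩
    nodeDemand x +ℤ ℤ∑.sum {r} (λ i → nodeDemand (suc x + toℕ i))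
      ≡⟨ cong (nodeDemand x +ℤ_) (tail-demand r (suc x) (trans (sym (+-suc x r)) x+1+r≡n)) ⟩
    nodeDemand x +ℤ + demandAt (suc x)
      ≡⟨ b2ℤ-balance (hasTarget x) (hasAgent x) _ _ (demand-balance x (subst (x <_) x+1+r≡n (m<m+n x z<s))) ⟩
    + demandAt x ∎
    where open ≡-Reasoning

  endToEnd-demand : ∀ u → demand endToEnd u ≡ + demandAt (toℕ u)
  endToEnd-demand u = begin
    demand endToEnd u
      ≡⟨ demand≡∑ endToEnd u ⟩
    ℤ∑.sum {n} (λ v → if inSubtree path u v then nodeDemand (toℕ v) else + 0)
      ≡⟨ ℤ∑.sum-cong-≗ {n} (λ v → cong (λ b → if b then nodeDemand (toℕ v) else + 0) (path-inSubtree u v)) ⟩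
    ℤ∑.sum {n} (λ v → if x ≤ᵇ toℕ v then nodeDemand (toℕ v) else + 0)
      ≡⟨ cong (λ N → ℤ∑.sum {N} (λ v → if x ≤ᵇ toℕ v then nodeDemand (toℕ v) else + 0)) (sym x+[n∸x]≡n) ⟩
    ℤ∑.sum {x + (n ∸ x)} (λ v → if x ≤ᵇ toℕ v then nodeDemand (toℕ v) else + 0)
      ≡⟨ ℤIndexedSums.∑-toℕ-from x (n ∸ x) nodeDemand ⟩
    ℤ∑.sum {n ∸ x} (λ i → nodeDemand (x + toℕ i))
      ≡⟨ tail-demand (n ∸ x) x x+[n∸x]≡n ⟩
    + demandAt x ∎
    where
    open ≡-Reasoning
    x : ℕ
    x = toℕ u
    x+[n∸x]≡n : x + (n ∸ x) ≡ n
    x+[n∸x]≡n = m+[n∸m]≡n (<⇒≤ (toℕ<n u))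

  -- The plan of process_subtree(r)

  sendTimes : ℕ → List ℕ
  sendTimes x = upFrom (x ∸ k′) (demandAt (suc x))

  received : ℕ → List ℕ
  received zero    = []
  received (suc x) = map suc (sendTimes x)

  Active : ℕ → ℕ → Set
  Active x t = t ≤ x × x < t + k × t < g

  sendTimes-end : ∀ {x} → x < n → x ∸ k′ + demandAt (suc x) ≡ suc x ⊓ g
  sendTimes-end {x} x<n = m+[n∸m]≡n (⊓-glb (≤-trans (m∸n≤m x k′) (n≤1+n x)) (m≤n+o⇒m∸n≤o x k′ (s≤s⁻¹ x<n)))

  sendTimes-sound : ∀ {x t} → x < n → t ∈ sendTimes x → t < g
  sendTimes-sound {x} x<n t∈ =
    ≤-trans (subst (_ <_) (sendTimes-end x<n) (proj₂ (∈-upFrom⁻ _ _ t∈))) (m⊓n≤n (suc x) g)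

  sendTimes-complete : ∀ {x t} → x < n → Active x t → t ∈ sendTimes x
  sendTimes-complete {x} {t} x<n (t≤x , x<t+k , t<g) = ∈-upFrom⁺ _ _
    (m≤n+o⇒m∸n≤o x k′ (subst (x ≤_) (+-comm t k′) (s≤s⁻¹ (subst (x <_) (+-suc t k′) x<t+k))))
    (subst (t <_) (sym (sendTimes-end x<n)) (⊓-glb (s≤s t≤x) t<g))

  list-after-push : ∀ x → (if hasAgent x then 0 ∷ received x else received x) ≡
                          upFrom (x ∸ k′) (demandAt x + (if hasAgent x then 1 else 0))
  list-after-push zero rewrite 0∸n≡0 k′ = refl
  list-after-push (suc y) rewrite map-suc-upFrom (y ∸ k′) (demandAt (suc y)) with y <? k′
  ... | yes y<k′ rewrite dec-true (y <? k′) y<k′ | m≤n⇒m∸n≡0 (<⇒≤ y<k′) | m≤n⇒m∸n≡0 y<k′ =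
    cong (upFrom 0) (+-comm 1 _)
  ... | no y≮k′ rewrite dec-false (y <? k′) y≮k′ | +-∸-assoc 1 (≮⇒≥ y≮k′) =
    cong (upFrom (suc (y ∸ k′))) (sym (+-identityʳ _))

  sent-after-push : ∀ {x} → x < n →
    take (demandAt (suc x)) (upFrom (x ∸ k′) (demandAt x + (if hasAgent x then 1 else 0))) ≡ sendTimes x
  sent-after-push {x} x<n =
    take-upFrom (x ∸ k′) (≤-trans (m≤n+m _ _) (≤-reflexive (sym (demand-balance x x<n))))

  Forward : List (Move n) → Set
  Forward ms = ∀ {u v t} → (u , v , t) ∈ ms → toℕ v ≡ suc (toℕ u) × t < g

  Covers : ℕ → List (Move n) → Set
  Covers x ms = ∀ u t → toℕ u < x → Active (toℕ u) t → ∃[ v ] (u , v , t) ∈ ms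

  module _ {X X1 : Fin n} (X1≡1+X : toℕ X1 ≡ suc (toℕ X)) {ms : List (Move n)} {ts : List ℕ} where

    Forward-++ : Forward ms → (∀ {t} → t ∈ ts → t < g) → Forward (ms ++ map (λ t → (X , X1 , t)) ts)
    Forward-++ forward ts<g m∈ with ∈-++⁻ ms m∈
    ... | inj₁ m∈ms = forward m∈ms
    ... | inj₂ m∈new with ∈-map⁻ (λ t → (X , X1 , t)) m∈new
    ...   | t , t∈ts , refl = X1≡1+X , ts<g t∈ts

    Covers-++ : Covers (toℕ X) ms → (∀ t → Active (toℕ X) t → t ∈ ts) →
                Covers (suc (toℕ X)) (ms ++ map (λ t → (X , X1 , t)) ts)
    Covers-++ covers ts-complete u t u<1+X active with m≤n⇒m<n∨m≡n (s≤s⁻¹ u<1+X)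
    ... | inj₁ u<X = let v , m∈ = covers u t u<X active in v , ∈-++⁺ˡ m∈
    ... | inj₂ u≡X with refl ← toℕ-injective u≡X =
      X1 , ∈-++⁺ʳ ms (∈-map⁺ (λ t → (X , X1 , t)) (ts-complete t active))

  open Unfolding endToEnd

  afterVisit : Fin n → State n → State n
  afterVisit X σ = markProcessed X (sendAll X (pushStart X σ))

  record Ready (X : Fin n) (σ : State n) : Set where
    field
      demand-later : ∀ j → toℕ X < toℕ j → dS σ j ≡ + demandAt (toℕ j)
      demand-here  : isNeg (dS σ X) ≡ false
      lists-later  : ∀ j → toℕ X < toℕ j → lS σ j ≡ []
      list-here    : lS σ X ≡ received (toℕ X)
      unprocessed  : ∀ j → toℕ X < toℕ j → proc σ j ≡ false
      starts       : ∀ j → sS σ j ≡ 0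
      forward      : Forward (out σ)
      covers       : Covers (toℕ X) (out σ)

  module _ {X X1 : Fin n} (X1≡1+X : toℕ X1 ≡ suc (toℕ X)) {σ : State n} (ready : Ready X σ) where
    open Ready ready

    private
      x : ℕ
      x = toℕ X
      σ₁ σ₃ : State n
      σ₁ = pushStart X σ
      σ₃ = sendAll X σ₁
      X<X1 : x < toℕ X1
      X<X1 = subst (x <_) (sym X1≡1+X) ≤-refl
      X≢X1 : X ≢ X1
      X≢X1 eq = <-irrefl (cong toℕ eq) X<X1
      x<n : x < n
      x<n = toℕ<n X
      only-child : children path X ≡ [ X1 ]
      only-child = path-children-next X X1 X1≡1+X
      sent : take (demandAt (suc x)) (lS σ₁ X) ≡ sendTimes x
      sent = trans (cong (take _) (trans (pushStart-here X σ)
                   (trans (cong₂ (λ s l → if hasAgent x then s ∷ l else l) (starts X) list-here)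
                          (list-after-push x))))
                   (sent-after-push x<n)
      S : Sent path only-child σ₁ σ₃ (sendTimes x)
      S = subst (Sent path only-child σ₁ σ₃) sent
            (sendAll-child path only-child X≢X1 (lS σ₁ X) (demandAt (suc x)) σ₁ demand-here
              (trans (demand-later X1 X<X1) (cong (λ y → + demandAt y) X1≡1+X)))
      module S = Sent S
      below : ∀ {j} → toℕ X1 < toℕ j → x < toℕ j × j ≢ X1 × j ≢ X
      below X1<j = <-trans X<X1 X1<j , (λ { refl → <-irrefl refl X1<j }) ,
                   (λ { refl → <-irrefl refl (<-trans X<X1 X1<j) })

    Ready-next : Ready X1 (afterVisit X σ)
    Ready-next = record
      { demand-later = λ j X1<j → let x<j , j≢X1 , _ = below X1<j in
                         trans (S.demand-other j≢X1) (demand-later j x<j)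
      ; demand-here  = S.demand-child
      ; lists-later  = λ j X1<j → let x<j , j≢X1 , j≢X = below X1<j in
                         trans (S.list-other j≢X1) (trans (pushStart-elsewhere X σ j≢X) (lists-later j x<j))
      ; list-here    = trans S.list-child
                         (trans (cong (_++ _) (trans (pushStart-elsewhere X σ (X≢X1 ∘ sym)) (lists-later X1 X<X1)))
                                (cong received (sym X1≡1+X)))
      ; unprocessed  = λ j X1<j → let x<j , _ , j≢X = below X1<j in
                         trans (upd-≢ (proc σ₃) X true j≢X)
                               (trans (cong (λ p → p j) S.proc-same) (unprocessed j x<j))
      ; starts       = λ j → trans (cong (λ s → s j) S.starts-same) (starts j)
      ; forward      = subst Forward (sym S.out-sent) (Forward-++ X1≡1+X forward (sendTimes-sound x<n))
      ; covers       = subst (λ ms → Covers (toℕ X1) ms) (sym S.out-sent)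
                         (subst (λ y → Covers y (out σ ++ map (λ t → (X , X1 , t)) (sendTimes x))) (sym X1≡1+X)
                           (Covers-++ X1≡1+X covers (λ t → sendTimes-complete x<n))) }

    processSubtree-next : ∀ f →
      processSubtree endToEnd (suc f) X σ ≡ processSubtree endToEnd f X1 (afterVisit X σ)
    processSubtree-next f = begin
      processSubtree endToEnd (suc f) X σ
        ≡⟨ processSubtree-unfold f X σ ⟩
      foldl (visit f) (markProcessed X (sendAll X (foldl (descend f X) σ₁ (children path X)))) (children path X)
        ≡⟨ cong (λ cs → foldl (visit f) (markProcessed X (sendAll X (foldl (descend f X) σ₁ cs))) cs) only-child ⟩
      visit f (markProcessed X (sendAll X (descend f X σ₁ X1))) X1
        ≡⟨ cong (λ σ₂ → visit f (markProcessed X (sendAll X σ₂)) X1)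
                (descend-nonneg f X σ₁ X1 (cong isNeg (demand-later X1 X<X1))) ⟩
      visit f (afterVisit X σ) X1
        ≡⟨ visit-unprocessed f (afterVisit X σ) X1 X1-unprocessed ⟩
      processSubtree endToEnd f X1 (afterVisit X σ) ∎
      where
      open ≡-Reasoning
      X1-unprocessed : proc (afterVisit X σ) X1 ≡ false
      X1-unprocessed = trans (upd-≢ (proc σ₃) X true (X≢X1 ∘ sym))
                             (trans (cong (λ p → p X1) S.proc-same) (unprocessed X1 X<X1))

  processSubtree-last : ∀ f {X σ} → toℕ X ≡ k′ + g → Ready X σ →
                        out (processSubtree endToEnd (suc f) X σ) ≡ out σ
  processSubtree-last f {X} {σ} X≡last ready = begin
    out (processSubtree endToEnd (suc f) X σ)
      ≡⟨ cong out (processSubtree-unfold f X σ) ⟩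
    out (foldl (visit f) (markProcessed X (sendAll X (foldl (descend f X) σ₁ (children path X))))
               (children path X))
      ≡⟨ cong (λ cs → out (foldl (visit f) (markProcessed X (sendAll X (foldl (descend f X) σ₁ cs))) cs))
              (path-children-last X X≡last) ⟩
    out (sendAll X σ₁)
      ≡⟨ cong out (sendAll-leaf path (path-children-last X X≡last) (lS σ₁ X) σ₁ (Ready.demand-here ready)) ⟩
    out σ ∎
    where
    open ≡-Reasoning
    σ₁ : State n
    σ₁ = pushStart X σ

  last-inactive : ∀ {t} → ¬ Active (k′ + g) t
  last-inactive {t} (_ , last<t+k , t<g) = <⇒≱ t<g (+-cancelˡ-≤ k′ g t (begin
    k′ + g ≤⟨ s≤s⁻¹ (subst (k′ + g <_) (+-suc t k′) last<t+k) ⟩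
    t + k′ ≡⟨ +-comm t k′ ⟩
    k′ + t ∎))
    where open ≤-Reasoning

  Covers-last : ∀ {ms} → Covers (k′ + g) ms → Covers n ms
  Covers-last covers u t u<n active with m≤n⇒m<n∨m≡n (s≤s⁻¹ u<n)
  ... | inj₁ u<last = covers u t u<last active
  ... | inj₂ u≡last = contradiction (subst (λ y → Active y t) u≡last active) last-inactive

  Correct : List (Move n) → Set
  Correct ms = Forward ms × Covers n ms

  process-ready : ∀ f X σ → n ≤ toℕ X + f → Ready X σ → Correct (out (processSubtree endToEnd f X σ))
  process-ready zero X σ n≤X+0 _ = contradiction (subst (n ≤_) (+-identityʳ _) n≤X+0) (<⇒≱ (toℕ<n X))
  process-ready (suc f) X σ n≤X+1+f ready with toℕ X <? k′ + g
  ... | yes X<last = subst Correct (cong out (sym (processSubtree-next X1≡1+X ready f)))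
    (process-ready f X1 (afterVisit X σ) n≤X1+f (Ready-next X1≡1+X ready))
    where
    X1 : Fin n
    X1 = fromℕ< (s≤s X<last)
    X1≡1+X : toℕ X1 ≡ suc (toℕ X)
    X1≡1+X = toℕ-fromℕ< (s≤s X<last)
    n≤X1+f : n ≤ toℕ X1 + f
    n≤X1+f = subst (n ≤_) (trans (+-suc (toℕ X) f) (cong (_+ f) (sym X1≡1+X))) n≤X+1+f
  ... | no X≮last = subst Correct (sym (processSubtree-last f X≡last ready))
    (forward , Covers-last (subst (λ y → Covers y (out σ)) X≡last covers))
    where
    open Ready ready
    X≡last : toℕ X ≡ k′ + g
    X≡last = ≤∧≮⇒≡ (s≤s⁻¹ (toℕ<n X)) X≮last

  initially-ready : Ready zero (initState endToEnd)
  initially-ready = record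
    { demand-later = λ j _ → endToEnd-demand j
    ; demand-here  = cong isNeg (endToEnd-demand zero)
    ; lists-later  = λ _ _ → refl
    ; list-here    = refl
    ; unprocessed  = λ _ _ → refl
    ; starts       = λ _ → refl
    ; forward      = λ ()
    ; covers       = λ _ _ () }

  plan-forward : Forward (plan endToEnd)
  plan-forward = proj₁ (process-ready n zero (initState endToEnd) ≤-refl initially-ready)

  plan-covers : Covers n (plan endToEnd)
  plan-covers = proj₂ (process-ready n zero (initState endToEnd) ≤-refl initially-ready)

  step-moving : ∀ {q T la} → Active (toℕ q) T →
    toℕ (proj₁ (stepAgent (plan endToEnd) T (q , la))) ≡ suc (toℕ q) ×
    proj₂ (stepAgent (plan endToEnd) T (q , la)) ≡ suc T
  step-moving {q} {T} active with moveFrom (plan endToEnd) q T in found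
  ... | just v  = proj₁ (plan-forward (moveFrom-∈ _ found)) , refl
  ... | nothing with v , m∈ ← plan-covers q T (toℕ<n q) active
                with () ← trans (sym found) (proj₂ (moveFrom-∋ _ m∈))

  step-waiting : ∀ {q T la} → g ≤ T → stepAgent (plan endToEnd) T (q , la) ≡ (q , la)
  step-waiting {q} {T} g≤T with moveFrom (plan endToEnd) q T in found
  ... | just v  = contradiction (proj₂ (plan-forward (moveFrom-∈ _ found))) (≤⇒≯ g≤T)
  ... | nothing = refl

  run : Fin n → ℕ → Fin n × ℕ
  run p T = foldl (λ a t → stepAgent (plan endToEnd) t a) (p , 0) (upTo T)

  run-suc : ∀ p T → run p (suc T) ≡ stepAgent (plan endToEnd) T (run p T)
  run-suc p T = trans (cong (foldl _ (p , 0)) (sym (upTo-∷ʳ T))) (foldl-++ _ (p , 0) (upTo T) [ T ])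

  run-agent : ∀ {p} → toℕ p < k → ∀ T → toℕ (proj₁ (run p T)) ≡ toℕ p + T ⊓ g × proj₂ (run p T) ≡ T ⊓ g
  run-agent p<k zero = sym (+-identityʳ _) , refl
  run-agent {p} p<k (suc T) rewrite run-suc p T with run p T | run-agent p<k T | T <? g
  ... | q , la | q≡p+T , la≡T | yes T<g =
    trans (proj₁ (step-moving {q} {T} {la} active))
          (trans (cong suc q≡p+T′) (trans (sym (+-suc (toℕ p) T)) (cong (_+_ (toℕ p)) (sym 1+T⊓g≡1+T)))) ,
    trans (proj₂ (step-moving {q} {T} {la} active)) (sym 1+T⊓g≡1+T)
    where
    1+T⊓g≡1+T : suc T ⊓ g ≡ suc T
    1+T⊓g≡1+T = m≤n⇒m⊓n≡m T<g
    q≡p+T′ : toℕ q ≡ toℕ p + T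
    q≡p+T′ = trans q≡p+T (cong (_+_ (toℕ p)) (m≤n⇒m⊓n≡m (<⇒≤ T<g)))
    active : Active (toℕ q) T
    active = subst (T ≤_) (sym q≡p+T′) (m≤n+m T (toℕ p)) ,
             subst (_< T + k) (sym q≡p+T′) (subst (_< T + k) (+-comm T (toℕ p)) (+-monoʳ-< T p<k)) ,
             T<g
  ... | q , la | q≡p+T , la≡T | no T≮g rewrite step-waiting {q} {T} {la} (≮⇒≥ T≮g) =
    trans q≡p+T (cong (_+_ (toℕ p)) T⊓g≡1+T⊓g) , trans la≡T T⊓g≡1+T⊓g
    where
    T⊓g≡1+T⊓g : T ⊓ g ≡ suc T ⊓ g
    T⊓g≡1+T⊓g = trans (m≥n⇒m⊓n≡n (≮⇒≥ T≮g)) (sym (m≥n⇒m⊓n≡n (m≤n⇒m≤1+n (≮⇒≥ T≮g))))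

  moves-at : ∀ {t} → t < g → ∃[ u ] ∃[ v ] (u , v , t) ∈ plan endToEnd
  moves-at {t} t<g = node , plan-covers node t (toℕ<n node) (t≤node , node<t+k , t<g)
    where
    t<n : t < n
    t<n = <-≤-trans t<g (m≤n+m g k)
    node : Fin n
    node = fromℕ< t<n
    t≤node : t ≤ toℕ node
    t≤node = ≤-reflexive (sym (toℕ-fromℕ< t<n))
    node<t+k : toℕ node < t + k
    node<t+k = subst (_< t + k) (sym (toℕ-fromℕ< t<n)) (m<m+n t z<s)

  g≤horizon : g ≤ horizon (plan endToEnd)
  g≤horizon = ≮⇒≥ λ horizon<g → let _ , _ , m∈ = moves-at horizon<g in <-irrefl refl (time<horizon m∈)

  pathLengths-endToEnd : pathLengths endToEnd ≡ replicate k g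
  pathLengths-endToEnd = begin
    pathLengths endToEnd
      ≡⟨ cong (map proj₂) (foldl-map-comm (stepAgent (plan endToEnd)) (map (λ p → (p , 0)) starters) (upTo H)) ⟩
    map proj₂ (map (λ a → foldl (λ a t → stepAgent (plan endToEnd) t a) a (upTo H))
                   (map (λ p → (p , 0)) starters))
      ≡⟨ trans (sym (map-∘ _)) (sym (map-∘ starters)) ⟩
    map (λ p → proj₂ (run p H)) starters
      ≡⟨ map-filterB-const agents (λ p → proj₂ (run p H)) arrives-at-g (allFin n) ⟩
    replicate (length starters) g
      ≡⟨ cong (λ m → replicate m g) (trans (length-filterB agents (allFin n)) (agent-count endToEnd)) ⟩
    replicate k g ∎
    where
    open ≡-Reasoning
    H : ℕ
    H = horizon (plan endToEnd)
    starters : List (Fin n)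
    starters = filterB agents (allFin n)
    arrives-at-g : ∀ p → agents p ≡ true → proj₂ (run p H) ≡ g
    arrives-at-g p p∈agents = trans (proj₂ (run-agent (<ᵇ⇒< (toℕ p) k (Equivalence.from T-≡ p∈agents)) H))
                                    (m≥n⇒m⊓n≡n g≤horizon)

  endToEnd-tight : makespan endToEnd ≡ g × sumOfCosts endToEnd ≡ k * g × OPTis endToEnd (k * g)
  endToEnd-tight = trans (cong maxList pathLengths-endToEnd) (maxList-replicate k′ g) ,
                   trans (cong sum pathLengths-endToEnd) (sum-replicate k g) ,
                   OPT

mainTheorem14 : (n k : ℕ) → 1 ≤ k → k ≤ n →
  Σ (Instance n k) (λ I →
    makespan I ≡ n ∸ k × sumOfCosts I ≡ k * (n ∸ k) × OPTis I (k * (n ∸ k)))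
mainTheorem14 n (suc k′) (s≤s z≤n) k≤n with n ∸ suc k′ | m+[n∸m]≡n k≤n
... | g | refl = EndToEnd.endToEnd k′ g , EndToEnd.endToEnd-tight k′ g
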